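{- Let $\mathcal{A}$ be a typed combinatory algebra over a type system $\mathcal{T}$ with a unit type $1\in\mathcal{T}$, i.e. $\mathcal{A}_1$ is a singleton $\{*\}$. Let $\mathbf{R}(\mathcal{A})$ be the category whose objects are the types of $\mathcal{T}$ and whose morphisms $A\to B$ are the computable functions $\mathcal{A}_A\to\mathcal{A}_B$ (with $1$ as terminal object). Then $\mathbf{Asm}(\mathcal{A})\cong\mathbf{Asm}(\mathbf{R}(\mathcal{A}))$ (isomorphism of categories).
   Context: A type system is a non-empty set $\mathcal{T}$ closed under a binary operation $\to$. A typed combinatory algebra (TCA) $\mathcal{A}$ over $\mathcal{T}$ is a family $(\mathcal{A}_A)_{A\in\mathcal{T}}$ of non-empty sets with application maps $\mathcal{A}_{A\to B}\times\mathcal{A}_A\to\mathcal{A}_B$, $(e,a)\mapsto ea$, such that there exist $\mathsf{k}_{A,B}\in\mathcal{A}_{A\to B\to A}$ and $\mathsf{s}_{A,B,C}\in\mathcal{A}_{(A\to B\to C)\to(A\to B)\to A\to C}$ with $\mathsf{k}ab=a$, $\mathsf{s}fga=fa(ga)$. A function $k:\mathcal{A}_A\to\mathcal{A}_B$ is computable if there exists $e\in\mathcal{A}_{A\to B}$ with $k(a)=ea$ for all $a\in\mathcal{A}_A$. $\mathbf{Asm}(\mathcal{A})$: objects are triples $(X,A,\Vdash_X)$ with $X$ a set, $A\in\mathcal{T}$, $\Vdash_X\subseteq\mathcal{A}_A\times X$ such that each $x$ has a realizer $a\Vdash_X x$; morphisms $(X,A,\Vdash_X)\to(Y,B,\Vdash_Y)$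 are functions $f:X\to Y$ for which some $e\in\mathcal{A}_{A\to B}$ satisfies $ea\Vdash_Y f(x)$ whenever $a\Vdash_X x$. For a category $\mathbf{R}$ with terminal object $1$, $\mathbf{Asm}(\mathbf{R})$ has objects triples $(X,A,\Vdash_X)$ with $X$ a set, $A$ an object of $\mathbf{R}$ and $\Vdash_X\subseteq\mathbf{R}(1,A)\times X$ such that each $x$ has some $a\Vdash_X x$; morphisms $(X,A,\Vdash_X)\to(Y,B,\Vdash_Y)$ are functions $f:X\to Y$ for which there is $e:A\to B$ in $\mathbf{R}$ with $e\circ a\Vdash_Y f(x)$ whenever $a\Vdash_X x$. -}

module Defs where

open import Level using (Level; _⊔_) renaming (suc to lsuc)
open import Data.Product using (Σ; _×_; _,_; proj₁; proj₂)
open import Relation.Binary.PropositionalEquality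
  using (_≡_; refl; sym; trans; cong; cong₂; subst)
open import Relation.Binary.Structures using (IsEquivalence)

record TypeSystem (t : Level) : Set (lsuc t) where
  infixr 5 _⇒_
  field
    Ty        : Set t
    _⇒_       : Ty → Ty → Ty
    someType  : Ty

record TCA {t : Level} (𝒯 : TypeSystem t) (a : Level) : Set (t ⊔ lsuc a) where
  open TypeSystem 𝒯
  infixl 9 _·_
  field
    𝒜        : Ty → Set a
    inhabited : (A : Ty) → 𝒜 A
    _·_      : ∀ {A B} → 𝒜 (A ⇒ B) → 𝒜 A → 𝒜 B
    k        : ∀ {A B} → 𝒜 (A ⇒ B ⇒ A)
    s        : ∀ {A B C} → 𝒜 ((A ⇒ B ⇒ C) ⇒ (A ⇒ B) ⇒ A ⇒ C)
    k-eq     : ∀ {A B} (x : 𝒜 A) (y : 𝒜 B) → k · x · y ≡ x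
    s-eq     : ∀ {A B C} (f : 𝒜 (A ⇒ B ⇒ C)) (g : 𝒜 (A ⇒ B)) (x : 𝒜 A) →
               s · f · g · x ≡ f · x · (g · x)

  Computable : ∀ {A B} → (𝒜 A → 𝒜 B) → Set a
  Computable {A} {B} f = Σ (𝒜 (A ⇒ B)) λ e → ∀ x → f x ≡ e · x

record UnitType {t a : Level} {𝒯 : TypeSystem t} (𝒜' : TCA 𝒯 a) : Set (t ⊔ a) where
  open TypeSystem 𝒯
  open TCA 𝒜'
  field
    𝟙        : Ty
    ⋆        : 𝒜 𝟙
    ⋆-unique : (x : 𝒜 𝟙) → x ≡ ⋆

record Category (o h e : Level) : Set (lsuc (o ⊔ h ⊔ e)) where
  infixr 9 _∘_
  infix  4 _≈_
  field
    Obj       : Set o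
    Hom       : Obj → Obj → Set h
    _≈_       : ∀ {A B} → Hom A B → Hom A B → Set e
    id        : ∀ {A} → Hom A A
    _∘_       : ∀ {A B C} → Hom B C → Hom A B → Hom A C
    ≈-equiv   : ∀ {A B} → IsEquivalence (_≈_ {A} {B})
    ∘-resp-≈  : ∀ {A B C} {f f' : Hom B C} {g g' : Hom A B} →
                f ≈ f' → g ≈ g' → f ∘ g ≈ f' ∘ g'
    assoc     : ∀ {A B C D} (f : Hom C D) (g : Hom B C) (h : Hom A B) →
                (f ∘ g) ∘ h ≈ f ∘ (g ∘ h)
    identityˡ : ∀ {A B} (f : Hom A B) → id ∘ f ≈ f
    identityʳ : ∀ {A B} (f : Hom A B) → f ∘ id ≈ f

record Terminal {o h e : Level} (C : Category o h e) : Set (o ⊔ h ⊔ e) where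
  open Category C
  field
    ⊤        : Obj
    !        : ∀ {A} → Hom A ⊤
    !-unique : ∀ {A} (f : Hom A ⊤) → f ≈ !

record Functor {o h e o' h' e' : Level}
               (C : Category o h e) (D : Category o' h' e')
               : Set (o ⊔ h ⊔ e ⊔ o' ⊔ h' ⊔ e') where
  private
    module C = Category C
    module D = Category D
  field
    F₀      : C.Obj → D.Obj
    F₁      : ∀ {A B} → C.Hom A B → D.Hom (F₀ A) (F₀ B)
    F-resp  : ∀ {A B} {f g : C.Hom A B} → f C.≈ g → F₁ f D.≈ F₁ g
    F-id    : ∀ {A} → F₁ (C.id {A}) D.≈ D.id
    F-∘     : ∀ {A B C'} (f : C.Hom B C') (g : C.Hom A B) →
              F₁ (f C.∘ g) D.≈ F₁ f D.∘ F₁ g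

-- We use the standard characterisation:
-- a functor which is bijective on objects and bijective on each hom-set
-- (i.e. full and faithful).
record CategoryIso {o h e o' h' e' q q' : Level}
                   (C : Category o h e) (D : Category o' h' e')
                   (_≋C_ : Category.Obj C → Category.Obj C → Set q)
                   (_≋D_ : Category.Obj D → Category.Obj D → Set q')
                   : Set (o ⊔ h ⊔ e ⊔ o' ⊔ h' ⊔ e' ⊔ q ⊔ q') where
  private
    module C = Category C
    module D = Category D
  field
    functor : Functor C D
  open Functor functor
  field
    F₀-resp      : ∀ {A B} → A ≋C B → F₀ A ≋D F₀ B
    F₀-injective : ∀ {A B} → F₀ A ≋D F₀ B → A ≋C B
    F₀-surjective : ∀ (Y : D.Obj) → Σ C.Obj λ X → F₀ X ≋D Y
    faithful     : ∀ {A B} (f g : C.Hom A B) → F₁ f D.≈ F₁ g → f C.≈ g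
    full         : ∀ {A B} (g : D.Hom (F₀ A) (F₀ B)) →
                   Σ (C.Hom A B) λ f → F₁ f D.≈ g

_↔ᵖ_ : ∀ {ℓ ℓ'} → Set ℓ → Set ℓ' → Set (ℓ ⊔ ℓ')
P ↔ᵖ Q = (P → Q) × (Q → P)

module AsmTCA {t a : Level} {𝒯 : TypeSystem t} (𝒜' : TCA 𝒯 a) (ℓ : Level) where
  open TypeSystem 𝒯
  open TCA 𝒜'

  record Obj : Set (lsuc ℓ ⊔ t ⊔ a) where
    field
      Carrier  : Set ℓ
      ty       : Ty
      _⊩_      : 𝒜 ty → Carrier → Set ℓ
      realized : (x : Carrier) → Σ (𝒜 ty) λ r → r ⊩ x
  open Obj public

  record Hom (X Y : Obj) : Set (ℓ ⊔ a) where
    field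
      fun     : Carrier X → Carrier Y
      tracked : Σ (𝒜 (ty X ⇒ ty Y)) λ e →
                ∀ {r x} → _⊩_ X r x → _⊩_ Y (e · r) (fun x)
  open Hom public

  _≋_ : Obj → Obj → Set (lsuc ℓ ⊔ t ⊔ a)
  X ≋ Y = Σ (Carrier X ≡ Carrier Y) λ p → Σ (ty X ≡ ty Y) λ q →
          ∀ r x → _⊩_ X r x ↔ᵖ _⊩_ Y (subst 𝒜 q r) (subst (λ S → S) p x)

  private
    comp-eq : ∀ {A B C} (e₂ : 𝒜 (B ⇒ C)) (e₁ : 𝒜 (A ⇒ B)) (r : 𝒜 A) →
              e₂ · (e₁ · r) ≡ s · (k · e₂) · e₁ · r
    comp-eq e₂ e₁ r = sym (trans (s-eq (k · e₂) e₁ r)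
                                 (cong (λ z → z · (e₁ · r)) (k-eq e₂ r)))

    id-eq : ∀ {A} (r : 𝒜 A) → r ≡ s · k · (k {A} {A}) · r
    id-eq {A} r = sym (trans (s-eq (k {A} {A ⇒ A}) (k {A} {A}) r) (k-eq r (k · r)))

  category : Category (lsuc ℓ ⊔ t ⊔ a) (ℓ ⊔ a) ℓ
  category = record
    { Obj = Obj
    ; Hom = Hom
    ; _≈_ = λ f g → ∀ x → fun f x ≡ fun g x
    ; id = λ {X} → record
        { fun = λ x → x
        ; tracked = s · k · k , λ {r} {x} rx → subst (λ z → _⊩_ X z x) (id-eq r) rx }
    ; _∘_ = λ {X} {Y} {Z} g f → record
        { fun = λ x → fun g (fun f x)
        ; tracked = s · (k · proj₁ (tracked g)) · proj₁ (tracked f)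
                  , λ {r} {x} rx →
                      subst (λ z → _⊩_ Z z (fun g (fun f x)))
                            (comp-eq (proj₁ (tracked g)) (proj₁ (tracked f)) r)
                            (proj₂ (tracked g) (proj₂ (tracked f) rx)) }
    ; ≈-equiv = record { refl = λ x → refl ; sym = λ p x → sym (p x)
                       ; trans = λ p q x → trans (p x) (q x) }
    ; ∘-resp-≈ = λ {_} {_} {_} {f} {f'} {g} {g'} p q x →
                   trans (cong (fun f) (q x)) (p (fun g' x))
    ; assoc = λ f g h x → refl
    ; identityˡ = λ f x → refl
    ; identityʳ = λ f x → refl
    }

module RTCA {t a : Level} {𝒯 : TypeSystem t} (𝒜' : TCA 𝒯 a) where
  open TypeSystem 𝒯
  open TCA 𝒜'

  CHom : Ty → Ty → Set a
  CHom A B = Σ (𝒜 A → 𝒜 B) Computable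

  category : Category t a a
  category = record
    { Obj = Ty
    ; Hom = CHom
    ; _≈_ = λ f g → ∀ x → proj₁ f x ≡ proj₁ g x
    ; id = λ {A} → (λ x → x) , s · k · k {A} {A} ,
                   λ x → sym (trans (s-eq (k {A} {A ⇒ A}) (k {A} {A}) x) (k-eq x (k · x)))
    ; _∘_ = λ g f → (λ x → proj₁ g (proj₁ f x))
                  , s · (k · proj₁ (proj₂ g)) · proj₁ (proj₂ f)
                  , λ x → trans (proj₂ (proj₂ g) (proj₁ f x))
                          (trans (cong (proj₁ (proj₂ g) ·_) (proj₂ (proj₂ f) x))
                          (sym (trans (s-eq (k · proj₁ (proj₂ g)) (proj₁ (proj₂ f)) x)
                                      (cong (λ z → z · (proj₁ (proj₂ f) · x))
                                            (k-eq (proj₁ (proj₂ g)) x)))))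
    ; ≈-equiv = record { refl = λ x → refl ; sym = λ p x → sym (p x)
                       ; trans = λ p q x → trans (p x) (q x) }
    ; ∘-resp-≈ = λ {_} {_} {_} {f} {f'} {g} {g'} p q x →
                   trans (cong (proj₁ f) (q x)) (p (proj₁ g' x))
    ; assoc = λ f g h x → refl
    ; identityˡ = λ f x → refl
    ; identityʳ = λ f x → refl
    }

  terminal : UnitType 𝒜' → Terminal category
  terminal u = record
    { ⊤ = 𝟙
    ; ! = λ {A} → (λ _ → ⋆) , k {𝟙} {A} · ⋆ , λ x → sym (k-eq ⋆ x)
    ; !-unique = λ f x → ⋆-unique (proj₁ f x)
    }
    where open UnitType u

-- Asm(R) for a category R with a terminal object 1.  Since hom-sets of R
-- are setoids here, the realizability relation is required to respect the
-- equality of morphisms (so it is a relation on the *set* R(1,A)).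

module AsmCat {o h e : Level} (R : Category o h e) (T : Terminal R) (ℓ : Level) where
  open Category R renaming (Obj to RObj; Hom to RHom)
  open Terminal T

  record Obj : Set (lsuc ℓ ⊔ o ⊔ h ⊔ e) where
    field
      Carrier  : Set ℓ
      obj      : RObj
      _⊩_      : RHom ⊤ obj → Carrier → Set ℓ
      ⊩-resp   : ∀ {r r' x} → r ≈ r' → r ⊩ x → r' ⊩ x
      realized : (x : Carrier) → Σ (RHom ⊤ obj) λ r → r ⊩ x
  open Obj public

  record Hom (X Y : Obj) : Set (ℓ ⊔ h) where
    field
      fun     : Carrier X → Carrier Y
      tracked : Σ (RHom (obj X) (obj Y)) λ e' →
                ∀ {r x} → _⊩_ X r x → _⊩_ Y (e' ∘ r) (fun x)
  open Hom public

  _≋_ : Obj → Obj → Set (lsuc ℓ ⊔ o ⊔ h)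
  X ≋ Y = Σ (Carrier X ≡ Carrier Y) λ p → Σ (obj X ≡ obj Y) λ q →
          ∀ r x → _⊩_ X r x ↔ᵖ _⊩_ Y (subst (RHom ⊤) q r) (subst (λ S → S) p x)

  private
    module E {A B} = IsEquivalence (≈-equiv {A} {B})

  category : Category (lsuc ℓ ⊔ o ⊔ h ⊔ e) (ℓ ⊔ h) ℓ
  category = record
    { Obj = Obj
    ; Hom = Hom
    ; _≈_ = λ f g → ∀ x → fun f x ≡ fun g x
    ; id = λ {X} → record
        { fun = λ x → x
        ; tracked = id , λ rx → ⊩-resp X (E.sym (identityˡ _)) rx }
    ; _∘_ = λ {X} {Y} {Z} g f → record
        { fun = λ x → fun g (fun f x)
        ; tracked = proj₁ (tracked g) ∘ proj₁ (tracked f)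
                  , λ rx → ⊩-resp Z (E.sym (assoc _ _ _))
                                    (proj₂ (tracked g) (proj₂ (tracked f) rx)) }
    ; ≈-equiv = record { refl = λ x → refl ; sym = λ p x → sym (p x)
                       ; trans = λ p q x → trans (p x) (q x) }
    ; ∘-resp-≈ = λ {_} {_} {_} {f} {f'} {g} {g'} p q x →
                   trans (cong (fun f) (q x)) (p (fun g' x))
    ; assoc = λ f g h x → refl
    ; identityˡ = λ f x → refl
    ; identityʳ = λ f x → refl
    }

-- The terminal object of R(𝒜) is the unit type, and a computable map 𝟙 → A
-- is determined by its value at ⋆; conversely every a ∈ 𝒜_A is the value of
-- the computable constant map k·a.  So global elements of A in R(𝒜) are
-- exactly the elements of 𝒜_A, and composing a tracker e : A → B in R(𝒜)
-- with a global element is application of a realizer of e.  Reading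
-- realizability relations through this correspondence turns assemblies over
-- 𝒜 into assemblies over R(𝒜) and back, leaving carriers, types and
-- underlying functions untouched.
module Submission where

open import Level using (Level)
open import Data.Product using (Σ; _,_; proj₁; proj₂)
open import Relation.Binary.PropositionalEquality using (_≡_; refl; sym; cong; subst)
open import Defs

module AsmIso {t a : Level} {𝒯 : TypeSystem t} (𝒜' : TCA 𝒯 a) (unit : UnitType 𝒜') (ℓ : Level) where
  open TypeSystem 𝒯
  open TCA 𝒜'
  open UnitType unit
  module A = AsmTCA 𝒜' ℓ
  module R = RTCA 𝒜'
  module B = AsmCat R.category (R.terminal unit) ℓ

  Point : Ty → Set a
  Point = R.CHom 𝟙

  point : ∀ {A} → 𝒜 A → Point A
  point v = (λ _ → v) , k · v , λ y → sym (k-eq v y)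

  value : ∀ {A} → Point A → 𝒜 A
  value r = proj₁ r ⋆

  point-value : ∀ {A} (r : Point A) (y : 𝒜 𝟙) → value r ≡ proj₁ r y
  point-value r y = cong (proj₁ r) (sym (⋆-unique y))

  value-subst : ∀ {A A'} (q : A ≡ A') (r : Point A) →
                value (subst Point q r) ≡ subst 𝒜 q (value r)
  value-subst refl r = refl

  ⊩-cong : ∀ (X : A.Obj) {v w x} → v ≡ w → A._⊩_ X v x → A._⊩_ X w x
  ⊩-cong X {x = x} = subst (λ z → A._⊩_ X z x)

  toAsmR : A.Obj → B.Obj
  toAsmR X = record
    { Carrier  = A.Carrier X
    ; obj      = A.ty X
    ; _⊩_      = λ r x → A._⊩_ X (value r) x
    ; ⊩-resp   = λ r≈r' → ⊩-cong X (r≈r' ⋆)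
    ; realized = λ x → point (proj₁ (A.realized X x)) , proj₂ (A.realized X x)
    }

  fromAsmR : B.Obj → A.Obj
  fromAsmR Y = record
    { Carrier  = B.Carrier Y
    ; ty       = B.obj Y
    ; _⊩_      = λ v x → B._⊩_ Y (point v) x
    ; realized = λ x → let (r , rx) = B.realized Y x in
                       value r , B.⊩-resp Y (λ y → sym (point-value r y)) rx
    }

  toAsmR-fromAsmR : ∀ Y → toAsmR (fromAsmR Y) B.≋ Y
  toAsmR-fromAsmR Y = refl , refl , λ r x →
      B.⊩-resp Y (point-value r)
    , B.⊩-resp Y (λ y → sym (point-value r y))

  toAsmR-resp-≋ : ∀ {X Y} → X A.≋ Y → toAsmR X B.≋ toAsmR Y
  toAsmR-resp-≋ {X} {Y} (p , q , h) = p , q , λ r x →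
      (λ rx → ⊩-cong Y (sym (value-subst q r)) (proj₁ (h (value r) x) rx))
    , (λ ry → proj₂ (h (value r) x) (⊩-cong Y (value-subst q r) ry))

  toAsmR-reflects-≋ : ∀ {X Y} → toAsmR X B.≋ toAsmR Y → X A.≋ Y
  toAsmR-reflects-≋ {X} {Y} (p , q , h) = p , q , λ v x →
      (λ rx → ⊩-cong Y (value-subst q (point v)) (proj₁ (h (point v) x) rx))
    , (λ ry → proj₂ (h (point v) x) (⊩-cong Y (sym (value-subst q (point v))) ry))

  toAsmR-hom : ∀ {X Y} → A.Hom X Y → B.Hom (toAsmR X) (toAsmR Y)
  toAsmR-hom f = record
    { fun     = A.fun f
    ; tracked = (proj₁ (A.tracked f) ·_ , proj₁ (A.tracked f) , λ _ → refl)
              , proj₂ (A.tracked f)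
    }

  functor : Functor A.category B.category
  functor = record
    { F₀     = toAsmR
    ; F₁     = toAsmR-hom
    ; F-resp = λ f≈g → f≈g
    ; F-id   = λ _ → refl
    ; F-∘    = λ _ _ _ → refl
    }

  toAsmR-hom-full : ∀ {X Y} (g : B.Hom (toAsmR X) (toAsmR Y)) →
                    Σ (A.Hom X Y) λ f → ∀ x → A.fun f x ≡ B.fun g x
  toAsmR-hom-full {X} {Y} g = record
      { fun     = B.fun g
      ; tracked = e , λ {v} {x} vx →
          ⊩-cong Y (realizes v) (proj₂ (B.tracked g) {point v} {x} vx)
      }
    , λ _ → refl
    where
    tracker : 𝒜 (A.ty X) → 𝒜 (A.ty Y)
    tracker = proj₁ (proj₁ (B.tracked g))
    e : 𝒜 (A.ty X ⇒ A.ty Y)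
    e = proj₁ (proj₂ (proj₁ (B.tracked g)))
    realizes : ∀ v → tracker v ≡ e · v
    realizes = proj₂ (proj₂ (proj₁ (B.tracked g)))

  iso : CategoryIso A.category B.category A._≋_ B._≋_
  iso = record
    { functor       = functor
    ; F₀-resp       = λ {X} {Y} → toAsmR-resp-≋ {X} {Y}
    ; F₀-injective  = λ {X} {Y} → toAsmR-reflects-≋ {X} {Y}
    ; F₀-surjective = λ Y → fromAsmR Y , toAsmR-fromAsmR Y
    ; faithful      = λ _ _ f≈g → f≈g
    ; full          = toAsmR-hom-full
    }

mainTheorem2 : ∀ {t a : Level} {𝒯 : TypeSystem t} (𝒜 : TCA 𝒯 a) (unit : UnitType 𝒜) (ℓ : Level) →
    CategoryIso (AsmTCA.category 𝒜 ℓ)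
                (AsmCat.category (RTCA.category 𝒜) (RTCA.terminal 𝒜 unit) ℓ)
                (AsmTCA._≋_ 𝒜 ℓ)
                (AsmCat._≋_ (RTCA.category 𝒜) (RTCA.terminal 𝒜 unit) ℓ)
mainTheorem2 𝒜 unit ℓ = AsmIso.iso 𝒜 unit ℓ
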